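{- For every $n\ge 9$ there exists a matching $M$ of $B(Q_n)$ that cannot be extended to a Hamilton path using only edges from $Q_n$; that is, there is no Hamilton path (with any endpoints) on the vertex set of $Q_n$ whose edge set is the union of $M$ with a set of edges of $Q_n$.
   Context: $Q_n$ has vertex set $\{0,1\}^n$, two vertices adjacent iff they differ in exactly one coordinate; the parity of a vertex is the parity of its number of ones. $B(Q_n)$ is the complete bipartite graph on $V(Q_n)$ with an edge between every pair of vertices of opposite parity. -}

module Defs where

open import Data.Nat using (ℕ; zero; suc; _+_; _%_)
open import Data.Bool using (Bool; true; false; if_then_else_)
open import Data.Bool.Properties using () renaming (_≟_ to _≟ᵇ_)
open import Data.Vec using (Vec; []; _∷_)
open import Data.List using (List; []; _∷_; concatMap)
open import Data.List.Membership.Propositional using (_∈_)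
open import Data.List.Relation.Unary.Unique.Propositional using (Unique)
open import Data.Product using (_×_; _,_)
open import Data.Sum using (_⊎_)
open import Data.Unit using (⊤)
open import Relation.Nullary using (¬_; yes; no)
open import Relation.Binary.PropositionalEquality using (_≡_)

Vertex : ℕ → Set
Vertex n = Vec Bool n

ones : ∀ {n} → Vertex n → ℕ
ones []          = 0
ones (true ∷ xs)  = suc (ones xs)
ones (false ∷ xs) = ones xs

parity : ∀ {n} → Vertex n → ℕ
parity v = ones v % 2

hamming : ∀ {n} → Vertex n → Vertex n → ℕ
hamming []       []       = 0
hamming (x ∷ xs) (y ∷ ys) with x ≟ᵇ y
... | yes _ = hamming xs ys
... | no  _ = suc (hamming xs ys)

QEdge : ∀ {n} → Vertex n → Vertex n → Set
QEdge u v = hamming u v ≡ 1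

-- edges of B(Q_n): vertices of opposite parity
BEdge : ∀ {n} → Vertex n → Vertex n → Set
BEdge u v = ¬ (parity u ≡ parity v)

endpoints : ∀ {A : Set} → List (A × A) → List A
endpoints = concatMap (λ { (u , v) → u ∷ v ∷ [] })

IsMatchingB : ∀ {n} → List (Vertex n × Vertex n) → Set
IsMatchingB {n} M = (∀ {u v} → (u , v) ∈ M → BEdge u v) × Unique (endpoints M)

_∈ₑ_ : ∀ {A : Set} → A × A → List (A × A) → Set
(u , v) ∈ₑ M = ((u , v) ∈ M) ⊎ ((v , u) ∈ M)

AllConsec : ∀ {A : Set} → (A → A → Set) → List A → Set
AllConsec R []           = ⊤
AllConsec R (x ∷ [])     = ⊤
AllConsec R (x ∷ y ∷ xs) = R x y × AllConsec R (y ∷ xs)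

data Consec {A : Set} (u v : A) : List A → Set where
  here  : ∀ {xs} → Consec u v (u ∷ v ∷ xs)
  there : ∀ {x xs} → Consec u v xs → Consec u v (x ∷ xs)

IsHamiltonSeq : ∀ {n} → List (Vertex n) → Set
IsHamiltonSeq {n} P = Unique P × (∀ (v : Vertex n) → v ∈ P)

-- P is a Hamilton path whose edge set is M ∪ F for some set F of edges
-- of Q_n: every edge of M is an edge of P, and every edge of P lies in
-- M or in Q_n.
ExtendsTo : ∀ {n} → List (Vertex n × Vertex n) → List (Vertex n) → Set
ExtendsTo {n} M P =
  IsHamiltonSeq P
  × (∀ {u v} → (u , v) ∈ M → Consec u v P ⊎ Consec v u P)
  × AllConsec (λ a b → ((a , b) ∈ₑ M) ⊎ QEdge a b) P

-- Split a vertex of Q_(9+m) into a 9-bit prefix and a suffix.  Call it heavyEven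
-- if it is even and its prefix has weight ≥ 6, heavyOdd if it is odd and its
-- prefix has weight ≥ 5.  Complementing the prefix sends a heavyOdd vertex to a
-- vertex of opposite parity whose prefix has weight ≤ 4; these pairs form the
-- matching M.  In a Hamilton path extending M, a heavyEven vertex is not covered
-- by M and all its cube neighbours are heavyOdd, so both its path neighbours are
-- heavyOdd, while a heavyOdd vertex has its partner as one path neighbour and so
-- is next to at most one heavyEven vertex.  Hence 2·#heavyEven ≤ #heavyOdd + 2.
-- Counting prefixes, #heavyEven = 93E + 37O and #heavyOdd = 163E + 93O, where
-- E ≥ max(O, 1) are the numbers of even and odd suffixes; this contradicts the
-- inequality.
module Submission where

open import Defs
open import Data.Nat using (ℕ; _≤_)
open import Data.List using (List)
open import Data.Product using (Σ; _×_)
open import Relation.Nullary using (¬_)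

open import Data.Bool using (Bool; true; false; not; _xor_)
open import Data.Bool.Properties
  using (not-involutive; not-distribˡ-xor; not-distribʳ-xor; xor-annihilates-not; not-¬)
open import Data.Empty using (⊥-elim)
open import Data.Product using (_,_; proj₁; proj₂)
open import Data.List using ([]; _∷_; [_]; map; _++_; filter; length)
open import Data.List.Properties using (filter-++; length-++; map-++; map-∘)
open import Data.List.Membership.Propositional using (_∈_)
open import Data.List.Membership.Propositional.Properties
  using (∈-map⁺; ∈-map⁻; ∈-++⁺ˡ; ∈-++⁺ʳ; ∈-filter⁺; ∈-filter⁻)
open import Data.List.Membership.Propositional.Properties.WithK using (unique∧set⇒bag)
open import Data.List.Relation.Binary.BagAndSetEquality using (∼bag⇒↭)
open import Data.List.Relation.Binary.Permutation.Propositional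
  using (_↭_; ↭-refl; ↭-prep; ↭-sym; ↭-trans; ↭⇒↭ₛ)
open import Data.List.Relation.Binary.Permutation.Propositional.Properties
  using (shift; map⁺; filter-↭; ↭-length)
import Data.List.Relation.Binary.Permutation.Setoid.Properties as PermutationSetoid
open import Data.List.Relation.Unary.All as All using ([])
open import Data.List.Relation.Unary.AllPairs using ([]; _∷_)
open import Data.List.Relation.Unary.Any using (here; there)
open import Data.List.Relation.Unary.Unique.Propositional using (Unique)
import Data.List.Relation.Unary.Unique.Propositional.Properties as Unique
open import Data.Nat using (zero; suc; _+_; _*_; _%_; _<_; z≤n; s≤s; s≤s⁻¹)
open import Data.Nat.DivMod using ([m+n]%n≡m%n)
open import Data.Nat.Properties
  using ( _≤?_; ≤-refl; ≤-reflexive; ≤-trans; ≤⇒≯; n≤1+n; n<1+n; m≤n⇒m≤1+n; m≤m+n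
        ; m≤n⇒∃[o]m+o≡n; +-comm; +-suc; +-mono-≤; +-monoˡ-≤; +-monoʳ-≤; +-cancelʳ-≤
        ; *-monoʳ-≤; module ≤-Reasoning)
open import Data.Nat.Tactic.RingSolver using (solve-∀)
open import Data.Sum using (_⊎_; inj₁; inj₂)
open import Data.Unit using (⊤)
open import Data.Vec using ([]; _∷_; take)
open import Data.Vec.Properties using (∷-injectiveʳ)
open import Function.Base using (_∘_)
open import Function.Bundles using (mk⇔)
open import Relation.Binary.Definitions using (DecidableEquality)
open import Relation.Binary.PropositionalEquality
  using (_≡_; _≢_; refl; sym; trans; cong; cong₂; subst; subst₂; module ≡-Reasoning)
open import Relation.Binary.PropositionalEquality.Properties using (setoid)
open import Relation.Nullary using (Dec; yes; no; contradiction)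

oddᵇ : ℕ → Bool
oddᵇ zero    = false
oddᵇ (suc n) = not (oddᵇ n)

oddᵇ-%2 : ∀ n → oddᵇ (n % 2) ≡ oddᵇ n
oddᵇ-%2 0             = refl
oddᵇ-%2 1             = refl
oddᵇ-%2 (suc (suc n)) = begin
  oddᵇ (suc (suc n) % 2) ≡⟨ cong (λ k → oddᵇ (k % 2)) (+-comm 2 n) ⟩
  oddᵇ ((n + 2) % 2)     ≡⟨ cong oddᵇ ([m+n]%n≡m%n n 2) ⟩
  oddᵇ (n % 2)           ≡⟨ oddᵇ-%2 n ⟩
  oddᵇ n                 ≡⟨ not-involutive (oddᵇ n) ⟨
  oddᵇ (suc (suc n))     ∎
  where open ≡-Reasoning

hamming-refl : ∀ {n} (v : Vertex n) → hamming v v ≡ 0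
hamming-refl []          = refl
hamming-refl (true ∷ v)  = hamming-refl v
hamming-refl (false ∷ v) = hamming-refl v

hamming-comm : ∀ {n} (u v : Vertex n) → hamming u v ≡ hamming v u
hamming-comm []          []          = refl
hamming-comm (true ∷ u)  (true ∷ v)  = hamming-comm u v
hamming-comm (true ∷ u)  (false ∷ v) = cong suc (hamming-comm u v)
hamming-comm (false ∷ u) (true ∷ v)  = cong suc (hamming-comm u v)
hamming-comm (false ∷ u) (false ∷ v) = hamming-comm u v

hamming-take≤ : ∀ k {m} (u v : Vertex (k + m)) → hamming (take k u) (take k v) ≤ hamming u v
hamming-take≤ zero    u           v           = z≤n
hamming-take≤ (suc k) (true ∷ u)  (true ∷ v)  = hamming-take≤ k u v
hamming-take≤ (suc k) (true ∷ u)  (false ∷ v) = s≤s (hamming-take≤ k u v)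
hamming-take≤ (suc k) (false ∷ u) (true ∷ v)  = s≤s (hamming-take≤ k u v)
hamming-take≤ (suc k) (false ∷ u) (false ∷ v) = hamming-take≤ k u v

oddᵇ-ones : ∀ {n} (u v : Vertex n) → oddᵇ (ones u) ≡ oddᵇ (hamming u v) xor oddᵇ (ones v)
oddᵇ-ones []          []          = refl
oddᵇ-ones (true ∷ u)  (true ∷ v)  =
  trans (cong not (oddᵇ-ones u v)) (not-distribʳ-xor (oddᵇ (hamming u v)) (oddᵇ (ones v)))
oddᵇ-ones (true ∷ u)  (false ∷ v) =
  trans (cong not (oddᵇ-ones u v)) (not-distribˡ-xor (oddᵇ (hamming u v)) (oddᵇ (ones v)))
oddᵇ-ones (false ∷ u) (true ∷ v)  =
  trans (oddᵇ-ones u v) (sym (xor-annihilates-not (oddᵇ (hamming u v)) (oddᵇ (ones v))))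
oddᵇ-ones (false ∷ u) (false ∷ v) = oddᵇ-ones u v

ones≤hamming+ones : ∀ {n} (u v : Vertex n) → ones u ≤ hamming u v + ones v
ones≤hamming+ones []          []          = z≤n
ones≤hamming+ones (true ∷ u)  (true ∷ v)  =
  ≤-trans (s≤s (ones≤hamming+ones u v)) (≤-reflexive (sym (+-suc (hamming u v) (ones v))))
ones≤hamming+ones (true ∷ u)  (false ∷ v) = s≤s (ones≤hamming+ones u v)
ones≤hamming+ones (false ∷ u) (true ∷ v)  =
  m≤n⇒m≤1+n (≤-trans (ones≤hamming+ones u v) (+-monoʳ-≤ (hamming u v) (n≤1+n (ones v))))
ones≤hamming+ones (false ∷ u) (false ∷ v) = ones≤hamming+ones u v

oddDistance⇒BEdge : ∀ {n} (u v : Vertex n) → oddᵇ (hamming u v) ≡ true → BEdge u v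
oddDistance⇒BEdge u v oddDistance sameParity = not-¬ sameOddᵇ oppositeOddᵇ
  where
  sameOddᵇ : oddᵇ (ones u) ≡ oddᵇ (ones v)
  sameOddᵇ = trans (sym (oddᵇ-%2 (ones u))) (trans (cong oddᵇ sameParity) (oddᵇ-%2 (ones v)))
  oppositeOddᵇ : oddᵇ (ones u) ≡ not (oddᵇ (ones v))
  oppositeOddᵇ = trans (oddᵇ-ones u v) (cong (_xor oddᵇ (ones v)) oddDistance)

flipFirst : ∀ k {m} → Vertex (k + m) → Vertex (k + m)
flipFirst zero    v       = v
flipFirst (suc k) (b ∷ v) = not b ∷ flipFirst k v

flipFirst-involutive : ∀ k {m} (v : Vertex (k + m)) → flipFirst k (flipFirst k v) ≡ v
flipFirst-involutive zero    v       = refl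
flipFirst-involutive (suc k) (b ∷ v) = cong₂ _∷_ (not-involutive b) (flipFirst-involutive k v)

flipFirst-injective : ∀ k {m} {u v : Vertex (k + m)} → flipFirst k u ≡ flipFirst k v → u ≡ v
flipFirst-injective k {u = u} {v} eq =
  trans (sym (flipFirst-involutive k u)) (trans (cong (flipFirst k) eq) (flipFirst-involutive k v))

hamming-flipFirst : ∀ k {m} (v : Vertex (k + m)) → hamming (flipFirst k v) v ≡ k
hamming-flipFirst zero    v           = hamming-refl v
hamming-flipFirst (suc k) (true ∷ v)  = cong suc (hamming-flipFirst k v)
hamming-flipFirst (suc k) (false ∷ v) = cong suc (hamming-flipFirst k v)

ones-take-flipFirst : ∀ k {m} (v : Vertex (k + m)) → ones (take k (flipFirst k v)) + ones (take k v) ≡ k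
ones-take-flipFirst zero    v           = refl
ones-take-flipFirst (suc k) (true ∷ v)  = trans (+-suc _ _) (cong suc (ones-take-flipFirst k v))
ones-take-flipFirst (suc k) (false ∷ v) = cong suc (ones-take-flipFirst k v)

BEdge-flipFirst : ∀ k {m} (v : Vertex (k + m)) → oddᵇ k ≡ true → BEdge v (flipFirst k v)
BEdge-flipFirst k v oddK =
  oddDistance⇒BEdge v (flipFirst k v)
    (trans (cong oddᵇ (trans (hamming-comm v (flipFirst k v)) (hamming-flipFirst k v))) oddK)

vertices : ∀ n → List (Vertex n)
vertices zero    = [ [] ]
vertices (suc n) = map (true ∷_) (vertices n) ++ map (false ∷_) (vertices n)

∈-vertices : ∀ {n} (v : Vertex n) → v ∈ vertices n
∈-vertices []                  = here refl
∈-vertices {suc n} (true ∷ v)  = ∈-++⁺ˡ (∈-map⁺ (true ∷_) (∈-vertices v))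
∈-vertices {suc n} (false ∷ v) =
  ∈-++⁺ʳ (map (true ∷_) (vertices n)) (∈-map⁺ (false ∷_) (∈-vertices v))

vertices-unique : ∀ n → Unique (vertices n)
vertices-unique zero    = [] ∷ []
vertices-unique (suc n) =
  Unique.++⁺ (Unique.map⁺ ∷-injectiveʳ (vertices-unique n))
             (Unique.map⁺ ∷-injectiveʳ (vertices-unique n))
             firstBitDiffers
  where
  firstBitDiffers : ∀ {v} → ¬ (v ∈ map (true ∷_) (vertices n) × v ∈ map (false ∷_) (vertices n))
  firstBitDiffers (inTrue , inFalse) with ∈-map⁻ (true ∷_) inTrue | ∈-map⁻ (false ∷_) inFalse
  ... | _ , _ , refl | _ , _ , ()

hamiltonian⇒↭vertices : ∀ {n} {P : List (Vertex n)} → IsHamiltonSeq P → P ↭ vertices n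
hamiltonian⇒↭vertices {n} (unique , complete) =
  ∼bag⇒↭ (unique∧set⇒bag unique (vertices-unique n)
                          (mk⇔ (λ _ → ∈-vertices _) (λ _ → complete _)))

Consec-∈ˡ : ∀ {A : Set} {u v : A} {xs} → Consec u v xs → u ∈ xs
Consec-∈ˡ here      = here refl
Consec-∈ˡ (there c) = there (Consec-∈ˡ c)

Consec-∈ʳ : ∀ {A : Set} {u v x : A} {xs} → Consec u v (x ∷ xs) → v ∈ xs
Consec-∈ʳ              here      = here refl
Consec-∈ʳ {xs = []}    (there ())
Consec-∈ʳ {xs = _ ∷ _} (there c) = there (Consec-∈ʳ c)

successor-unique : ∀ {A : Set} {u v w : A} {xs} → Unique xs → Consec u v xs → Consec u w xs → v ≡ w
successor-unique _            here       here       = refl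
successor-unique (u∉ ∷ _)     here       (there uw) = ⊥-elim (All.lookup u∉ (Consec-∈ˡ uw) refl)
successor-unique (u∉ ∷ _)     (there uv) here       = ⊥-elim (All.lookup u∉ (Consec-∈ˡ uv) refl)
successor-unique (_ ∷ unique) (there uv) (there uw) = successor-unique unique uv uw

predecessor-unique : ∀ {A : Set} {u v w : A} {xs} → Unique xs → Consec u w xs → Consec v w xs → u ≡ v
predecessor-unique _             here       here       = refl
predecessor-unique (_ ∷ w∉ ∷ _)  here       (there vw) = ⊥-elim (All.lookup w∉ (Consec-∈ʳ vw) refl)
predecessor-unique (_ ∷ w∉ ∷ _)  (there uw) here       = ⊥-elim (All.lookup w∉ (Consec-∈ʳ uw) refl)
predecessor-unique (_ ∷ unique)  (there uw) (there vw) = predecessor-unique unique uw vw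

AllConsec-tail : ∀ {A : Set} {R : A → A → Set} x xs → AllConsec R (x ∷ xs) → AllConsec R xs
AllConsec-tail x []       _       = _
AllConsec-tail x (y ∷ xs) (_ , c) = c

AllConsec-map : ∀ {A B : Set} {R : A → A → Set} {S : B → B → Set} (f : A → B) →
                (∀ {a b} → R a b → S (f a) (f b)) → ∀ xs → AllConsec R xs → AllConsec S (map f xs)
AllConsec-map f r []           _        = _
AllConsec-map f r (x ∷ [])     _        = _
AllConsec-map f r (x ∷ y ∷ xs) (xy , c) = r xy , AllConsec-map f r (y ∷ xs) c

AllTriples : ∀ {A : Set} → (A → A → A → Set) → List A → Set
AllTriples R (x ∷ y ∷ z ∷ xs) = R x y z × AllTriples R (y ∷ z ∷ xs)
AllTriples R _                = ⊤

AllTriples-tail : ∀ {A : Set} {R : A → A → A → Set} x xs → AllTriples R (x ∷ xs) → AllTriples R xs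
AllTriples-tail x []           _       = _
AllTriples-tail x (y ∷ [])     _       = _
AllTriples-tail x (y ∷ z ∷ xs) (_ , t) = t

consec⇒AllTriples-map : ∀ {A B : Set} {R : B → B → B → Set} (f : A → B) xs →
                        (∀ {a t b} → Consec a t xs → Consec t b xs → R (f a) (f t) (f b)) →
                        AllTriples R (map f xs)
consec⇒AllTriples-map f []               r = _
consec⇒AllTriples-map f (_ ∷ [])         r = _
consec⇒AllTriples-map f (_ ∷ _ ∷ [])     r = _
consec⇒AllTriples-map f (a ∷ t ∷ b ∷ xs) r =
  r here (there here) , consec⇒AllTriples-map f (t ∷ b ∷ xs) (λ at tb → r (there at) (there tb))

endpoints-graph-↭ : ∀ {A : Set} (f : A → A) xs → endpoints (map (λ x → x , f x) xs) ↭ xs ++ map f xs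
endpoints-graph-↭ f []       = ↭-refl
endpoints-graph-↭ f (x ∷ xs) =
  ↭-prep x (↭-trans (↭-prep (f x) (endpoints-graph-↭ f xs)) (↭-sym (shift (f x) xs (map f xs))))

endpoints-graph-unique : ∀ {A : Set} (f : A → A) xs → Unique (xs ++ map f xs) →
                         Unique (endpoints (map (λ x → x , f x) xs))
endpoints-graph-unique {A} f xs =
  PermutationSetoid.Unique-resp-↭ (setoid A) (↭⇒↭ₛ (↭-sym (endpoints-graph-↭ f xs)))

data Class : Set where
  heavyEven heavyOdd other : Class

_≟_ : DecidableEquality Class
heavyEven ≟ heavyEven = yes refl
heavyEven ≟ heavyOdd  = no λ ()
heavyEven ≟ other     = no λ ()
heavyOdd  ≟ heavyEven = no λ ()
heavyOdd  ≟ heavyOdd  = yes refl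
heavyOdd  ≟ other     = no λ ()
other     ≟ heavyEven = no λ ()
other     ≟ heavyOdd  = no λ ()
other     ≟ other     = yes refl

heavyEven≢other : heavyEven ≢ other
heavyEven≢other ()

heavyOdd≢other : heavyOdd ≢ other
heavyOdd≢other ()

count : Class → List Class → ℕ
count c ws = length (filter (_≟ c) ws)

count-++ : ∀ c xs ys → count c (xs ++ ys) ≡ count c xs + count c ys
count-++ c xs ys = trans (cong length (filter-++ (_≟ c) xs ys)) (length-++ (filter (_≟ c) xs))

count-↭ : ∀ c {xs ys} → xs ↭ ys → count c xs ≡ count c ys
count-↭ c xs↭ys = ↭-length (filter-↭ (_≟ c) xs↭ys)

Compatible : Class → Class → Set
Compatible heavyEven y         = y ≡ heavyOdd
Compatible x         heavyEven = x ≡ heavyOdd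
Compatible _         _         = ⊤

compatible : ∀ {x y} → (x ≡ heavyEven → y ≡ heavyOdd) → (y ≡ heavyEven → x ≡ heavyOdd) → Compatible x y
compatible {heavyEven}             f _ = f refl
compatible {heavyOdd}  {heavyEven} _ g = g refl
compatible {heavyOdd}  {heavyOdd}  _ _ = _
compatible {heavyOdd}  {other}     _ _ = _
compatible {other}     {heavyEven} _ g = g refl
compatible {other}     {heavyOdd}  _ _ = _
compatible {other}     {other}     _ _ = _

Sandwiched : Class → Class → Class → Set
Sandwiched a t b = a ≡ heavyEven × t ≡ heavyOdd × b ≡ heavyEven

Unsandwiched : List Class → Set
Unsandwiched = AllTriples (λ a t b → ¬ Sandwiched a t b)

startsHeavyEven : List Class → ℕ
startsHeavyEven (heavyEven ∷ _) = 1
startsHeavyEven _               = 0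

startsHeavyEven≤1 : ∀ ws → startsHeavyEven ws ≤ 1
startsHeavyEven≤1 []              = z≤n
startsHeavyEven≤1 (heavyEven ∷ _) = ≤-refl
startsHeavyEven≤1 (heavyOdd ∷ _)  = z≤n
startsHeavyEven≤1 (other ∷ _)     = z≤n

double-suc-≤ : ∀ {s n} → s + s ≤ n → suc s + suc s ≤ suc (suc n)
double-suc-≤ {s} h = s≤s (≤-trans (≤-reflexive (+-suc s s)) (s≤s h))

twice-heavyEven≤start+1+heavyOdd :
  ∀ ws → AllConsec Compatible ws → Unsandwiched ws →
  count heavyEven ws + count heavyEven ws ≤ startsHeavyEven ws + suc (count heavyOdd ws)
twice-heavyEven≤start+1+heavyOdd [] _ _ = z≤n
twice-heavyEven≤start+1+heavyOdd (heavyEven ∷ []) _ _ = ≤-refl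
twice-heavyEven≤start+1+heavyOdd (heavyEven ∷ heavyEven ∷ _) (() , _) _
twice-heavyEven≤start+1+heavyOdd (heavyEven ∷ other ∷ _) (() , _) _
twice-heavyEven≤start+1+heavyOdd (heavyEven ∷ heavyOdd ∷ []) _ _ = s≤s (s≤s z≤n)
twice-heavyEven≤start+1+heavyOdd (heavyEven ∷ heavyOdd ∷ heavyEven ∷ _) _ (unsandwiched , _) =
  ⊥-elim (unsandwiched (refl , refl , refl))
twice-heavyEven≤start+1+heavyOdd (heavyEven ∷ heavyOdd ∷ ws@(heavyOdd ∷ _)) (_ , _ , c) (_ , t) =
  double-suc-≤ (twice-heavyEven≤start+1+heavyOdd ws c (AllTriples-tail heavyOdd ws t))
twice-heavyEven≤start+1+heavyOdd (heavyEven ∷ heavyOdd ∷ ws@(other ∷ _)) (_ , _ , c) (_ , t) =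
  double-suc-≤ (twice-heavyEven≤start+1+heavyOdd ws c (AllTriples-tail heavyOdd ws t))
twice-heavyEven≤start+1+heavyOdd (heavyOdd ∷ ws) c t =
  ≤-trans (twice-heavyEven≤start+1+heavyOdd ws (AllConsec-tail heavyOdd ws c)
                                                (AllTriples-tail heavyOdd ws t))
          (+-monoˡ-≤ _ (startsHeavyEven≤1 ws))
twice-heavyEven≤start+1+heavyOdd (other ∷ []) _ _ = z≤n
twice-heavyEven≤start+1+heavyOdd (other ∷ heavyEven ∷ _) (() , _) _
twice-heavyEven≤start+1+heavyOdd (other ∷ ws@(heavyOdd ∷ _)) (_ , c) t =
  twice-heavyEven≤start+1+heavyOdd ws c (AllTriples-tail other ws t)
twice-heavyEven≤start+1+heavyOdd (other ∷ ws@(other ∷ _)) (_ , c) t =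
  twice-heavyEven≤start+1+heavyOdd ws c (AllTriples-tail other ws t)

twice-heavyEven≤2+heavyOdd : ∀ ws → AllConsec Compatible ws → Unsandwiched ws →
                             count heavyEven ws + count heavyEven ws ≤ 2 + count heavyOdd ws
twice-heavyEven≤2+heavyOdd ws c t =
  ≤-trans (twice-heavyEven≤start+1+heavyOdd ws c t) (+-monoˡ-≤ _ (startsHeavyEven≤1 ws))

-- The thresholds differ by one so that every cube neighbour of a heavyEven
-- vertex is heavyOdd.
classify : ℕ → Bool → Class
classify w false with 6 ≤? w
... | yes _ = heavyEven
... | no  _ = other
classify w true  with 5 ≤? w
... | yes _ = heavyOdd
... | no  _ = other

classify-heavyEven⁻¹ : ∀ w p → classify w p ≡ heavyEven → p ≡ false × 6 ≤ w
classify-heavyEven⁻¹ w false eq with 6 ≤? w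
classify-heavyEven⁻¹ w false eq | yes 6≤w = refl , 6≤w
classify-heavyEven⁻¹ w false () | no _
classify-heavyEven⁻¹ w true  eq with 5 ≤? w
classify-heavyEven⁻¹ w true  () | yes _
classify-heavyEven⁻¹ w true  () | no _

classify-heavyOdd⁻¹ : ∀ w p → classify w p ≡ heavyOdd → p ≡ true × 5 ≤ w
classify-heavyOdd⁻¹ w false eq with 6 ≤? w
classify-heavyOdd⁻¹ w false () | yes _
classify-heavyOdd⁻¹ w false () | no _
classify-heavyOdd⁻¹ w true  eq with 5 ≤? w
classify-heavyOdd⁻¹ w true  eq | yes 5≤w = refl , 5≤w
classify-heavyOdd⁻¹ w true  () | no _

classify-heavyOdd : ∀ {w} → 5 ≤ w → classify w true ≡ heavyOdd
classify-heavyOdd {w} 5≤w with 5 ≤? w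
... | yes _  = refl
... | no 5≰w = contradiction 5≤w 5≰w

classify-other : ∀ {w} → w ≤ 5 → classify w false ≡ other
classify-other {w} w≤5 with 6 ≤? w
... | yes 6≤w = contradiction 6≤w (≤⇒≯ w≤5)
... | no _    = refl

class : ∀ {m} → Vertex (9 + m) → Class
class v = classify (ones (take 9 v)) (oddᵇ (ones v))

heavyEven-neighbour : ∀ {m} (u v : Vertex (9 + m)) → QEdge u v → class u ≡ heavyEven → class v ≡ heavyOdd
heavyEven-neighbour u v uv uHeavyEven with classify-heavyEven⁻¹ _ _ uHeavyEven
... | uEven , 6≤wu =
  subst (λ p → classify (ones (take 9 v)) p ≡ heavyOdd) (sym vOdd) (classify-heavyOdd 5≤wv)
  where
  vOdd : oddᵇ (ones v) ≡ true
  vOdd = trans (oddᵇ-ones v u) (cong₂ (λ d p → oddᵇ d xor p) (trans (hamming-comm v u) uv) uEven)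
  5≤wv : 5 ≤ ones (take 9 v)
  5≤wv = s≤s⁻¹ (≤-trans 6≤wu (≤-trans (ones≤hamming+ones (take 9 u) (take 9 v))
                                      (+-monoˡ-≤ _ (≤-trans (hamming-take≤ 9 u v) (≤-reflexive uv)))))

QEdge⇒Compatible : ∀ {m} (u v : Vertex (9 + m)) → QEdge u v → Compatible (class u) (class v)
QEdge⇒Compatible u v uv =
  compatible (heavyEven-neighbour u v uv) (heavyEven-neighbour v u (trans (hamming-comm v u) uv))

flipFirst-heavyOdd : ∀ {m} (v : Vertex (9 + m)) → class v ≡ heavyOdd → class (flipFirst 9 v) ≡ other
flipFirst-heavyOdd v vHeavyOdd with classify-heavyOdd⁻¹ _ _ vHeavyOdd
... | vOdd , 5≤wv =
  subst (λ p → classify w′ p ≡ other) (sym flipEven) (classify-other (m≤n⇒m≤1+n w′≤4))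
  where
  w′ : ℕ
  w′ = ones (take 9 (flipFirst 9 v))
  flipEven : oddᵇ (ones (flipFirst 9 v)) ≡ false
  flipEven = trans (oddᵇ-ones (flipFirst 9 v) v)
                   (cong₂ (λ d p → oddᵇ d xor p) (hamming-flipFirst 9 v) vOdd)
  w′≤4 : w′ ≤ 4
  w′≤4 = +-cancelʳ-≤ 5 w′ 4 (≤-trans (+-monoʳ-≤ w′ 5≤wv) (≤-reflexive (ones-take-flipFirst 9 v)))

#even #odd : ℕ → ℕ
#even zero    = 1
#even (suc m) = #even m + #odd m
#odd  zero    = 0
#odd  (suc m) = #even m + #odd m

#odd≤#even : ∀ m → #odd m ≤ #even m
#odd≤#even zero    = z≤n
#odd≤#even (suc m) = ≤-refl

1≤#even : ∀ m → 1 ≤ #even m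
1≤#even zero    = ≤-refl
1≤#even (suc m) = ≤-trans (1≤#even m) (m≤m+n (#even m) (#odd m))

count-vertices-suc : ∀ c n (f : Vertex (suc n) → Class) →
  count c (map f (vertices (suc n)))
  ≡ count c (map (f ∘ (true ∷_)) (vertices n)) + count c (map (f ∘ (false ∷_)) (vertices n))
count-vertices-suc c n f = begin
  count c (map f (map (true ∷_) (vertices n) ++ map (false ∷_) (vertices n)))
    ≡⟨ cong (count c) (map-++ f (map (true ∷_) (vertices n)) _) ⟩
  count c (map f (map (true ∷_) (vertices n)) ++ map f (map (false ∷_) (vertices n)))
    ≡⟨ count-++ c (map f (map (true ∷_) (vertices n))) _ ⟩
  count c (map f (map (true ∷_) (vertices n))) + count c (map f (map (false ∷_) (vertices n)))
    ≡⟨ cong₂ (λ xs ys → count c xs + count c ys) (map-∘ (vertices n)) (map-∘ (vertices n)) ⟨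
  count c (map (f ∘ (true ∷_)) (vertices n)) + count c (map (f ∘ (false ∷_)) (vertices n)) ∎
  where open ≡-Reasoning

count-byParity : ∀ c m (g : Bool → Class) →
  count c (map (λ y → g (oddᵇ (ones y))) (vertices m))
  ≡ count c [ g false ] * #even m + count c [ g true ] * #odd m
count-byParity c zero    g = regroup (count c [ g false ]) (count c [ g true ])
  where
  regroup : ∀ a b → a ≡ a * 1 + b * 0
  regroup = solve-∀
count-byParity c (suc m) g = begin
  count c (map (λ y → g (oddᵇ (ones y))) (vertices (suc m)))
    ≡⟨ count-vertices-suc c m _ ⟩
  count c (map (λ y → g (not (oddᵇ (ones y)))) (vertices m))
    + count c (map (λ y → g (oddᵇ (ones y))) (vertices m))
    ≡⟨ cong₂ _+_ (count-byParity c m (g ∘ not)) (count-byParity c m g) ⟩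
  (b * #even m + a * #odd m) + (a * #even m + b * #odd m)
    ≡⟨ regroup a b (#even m) (#odd m) ⟩
  a * #even (suc m) + b * #odd (suc m) ∎
  where
  open ≡-Reasoning
  a b : ℕ
  a = count c [ g false ]
  b = count c [ g true ]
  regroup : ∀ a b e o → (b * e + a * o) + (a * e + b * o) ≡ a * (e + o) + b * (e + o)
  regroup = solve-∀

count-byPrefix : ∀ c k m (F : ℕ → Bool → Class) →
  count c (map (λ v → F (ones (take k v)) (oddᵇ (ones v))) (vertices (k + m)))
  ≡ count c (map (λ x → F (ones x) (oddᵇ (ones x))) (vertices k)) * #even m
    + count c (map (λ x → F (ones x) (not (oddᵇ (ones x)))) (vertices k)) * #odd m
count-byPrefix c zero    m F = count-byParity c m (F 0)
count-byPrefix c (suc k) m F = begin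
  count c (map (λ v → F (ones (take (suc k) v)) (oddᵇ (ones v))) (vertices (suc k + m)))
    ≡⟨ count-vertices-suc c (k + m) _ ⟩
  count c (map (λ v → F′ (ones (take k v)) (oddᵇ (ones v))) (vertices (k + m)))
    + count c (map (λ v → F (ones (take k v)) (oddᵇ (ones v))) (vertices (k + m)))
    ≡⟨ cong₂ _+_ (count-byPrefix c k m F′) (count-byPrefix c k m F) ⟩
  (#[ F′ ]ᵉ * #even m + #[ F′ ]ᵒ * #odd m) + (#[ F ]ᵉ * #even m + #[ F ]ᵒ * #odd m)
    ≡⟨ regroup #[ F′ ]ᵉ #[ F′ ]ᵒ #[ F ]ᵉ #[ F ]ᵒ (#even m) (#odd m) ⟩
  (#[ F′ ]ᵉ + #[ F ]ᵉ) * #even m + (#[ F′ ]ᵒ + #[ F ]ᵒ) * #odd m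
    ≡⟨ cong₂ (λ a b → a * #even m + b * #odd m) (count-vertices-suc c k _) (count-vertices-suc c k _) ⟨
  count c (map (λ x → F (ones x) (oddᵇ (ones x))) (vertices (suc k))) * #even m
    + count c (map (λ x → F (ones x) (not (oddᵇ (ones x)))) (vertices (suc k))) * #odd m ∎
  where
  open ≡-Reasoning
  F′ : ℕ → Bool → Class
  F′ w p = F (suc w) (not p)
  #[_]ᵉ #[_]ᵒ : (ℕ → Bool → Class) → ℕ
  #[ G ]ᵉ = count c (map (λ x → G (ones x) (oddᵇ (ones x))) (vertices k))
  #[ G ]ᵒ = count c (map (λ x → G (ones x) (not (oddᵇ (ones x)))) (vertices k))
  regroup : ∀ a′ b′ a b e o → (a′ * e + b′ * o) + (a * e + b * o) ≡ (a′ + a) * e + (b′ + b) * o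
  regroup = solve-∀

-- 93 = C(9,6) + C(9,8), 37 = C(9,7) + C(9,9), 163 = C(9,5) + C(9,7) + C(9,9).
count-heavyEven : ∀ m → count heavyEven (map class (vertices (9 + m))) ≡ 93 * #even m + 37 * #odd m
count-heavyEven m = count-byPrefix heavyEven 9 m classify

count-heavyOdd : ∀ m → count heavyOdd (map class (vertices (9 + m))) ≡ 163 * #even m + 93 * #odd m
count-heavyOdd m = count-byPrefix heavyOdd 9 m classify

heavyEven-excess : ∀ e o → o ≤ e → 1 ≤ e → 2 + (163 * e + 93 * o) < (93 * e + 37 * o) + (93 * e + 37 * o)
heavyEven-excess e o o≤e 1≤e = begin-strict
  2 + (163 * e + 93 * o)                <⟨ n<1+n _ ⟩
  3 + (163 * e + 93 * o)                ≡⟨ regroup₁ e o ⟩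
  (3 + 19 * o) + (163 * e + 74 * o)     ≤⟨ +-monoˡ-≤ _ (+-mono-≤ 3≤4e (*-monoʳ-≤ 19 o≤e)) ⟩
  (4 * e + 19 * e) + (163 * e + 74 * o) ≡⟨ regroup₂ e o ⟩
  (93 * e + 37 * o) + (93 * e + 37 * o) ∎
  where
  open ≤-Reasoning
  3≤4e : 3 ≤ 4 * e
  3≤4e = ≤-trans (n≤1+n 3) (*-monoʳ-≤ 4 1≤e)
  regroup₁ : ∀ e o → 3 + (163 * e + 93 * o) ≡ (3 + 19 * o) + (163 * e + 74 * o)
  regroup₁ = solve-∀
  regroup₂ : ∀ e o → (4 * e + 19 * e) + (163 * e + 74 * o) ≡ (93 * e + 37 * o) + (93 * e + 37 * o)
  regroup₂ = solve-∀

module _ (m : ℕ) where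

  heavyOdd? : ∀ v → Dec (class {m} v ≡ heavyOdd)
  heavyOdd? v = class v ≟ heavyOdd

  heavyOdds : List (Vertex (9 + m))
  heavyOdds = filter heavyOdd? (vertices (9 + m))

  ∈heavyOdds⁻ : ∀ {v} → v ∈ heavyOdds → class v ≡ heavyOdd
  ∈heavyOdds⁻ = proj₂ ∘ ∈-filter⁻ heavyOdd? {xs = vertices (9 + m)}

  heavyOdds-unique : Unique heavyOdds
  heavyOdds-unique = Unique.filter⁺ heavyOdd? {vertices (9 + m)} (vertices-unique (9 + m))

  matching : List (Vertex (9 + m) × Vertex (9 + m))
  matching = map (λ v → v , flipFirst 9 v) heavyOdds

  ∈matching⁻ : ∀ {u v} → (u , v) ∈ matching → class u ≡ heavyOdd × v ≡ flipFirst 9 u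
  ∈matching⁻ uv with ∈-map⁻ (λ v → v , flipFirst 9 v) uv
  ... | _ , u∈ , refl = ∈heavyOdds⁻ u∈ , refl

  ∈matching⁺ : ∀ v → class v ≡ heavyOdd → (v , flipFirst 9 v) ∈ matching
  ∈matching⁺ v vHeavyOdd =
    ∈-map⁺ (λ v → v , flipFirst 9 v) (∈-filter⁺ heavyOdd? (∈-vertices v) vHeavyOdd)

  matching-classes : ∀ {u v} → (u , v) ∈ matching → class u ≡ heavyOdd × class v ≡ other
  matching-classes {u} uv with ∈matching⁻ uv
  ... | uHeavyOdd , refl = uHeavyOdd , flipFirst-heavyOdd u uHeavyOdd

  matching-isMatchingB : IsMatchingB matching
  matching-isMatchingB =
    bEdge ,
    endpoints-graph-unique (flipFirst 9) heavyOdds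
      (Unique.++⁺ heavyOdds-unique (Unique.map⁺ (flipFirst-injective 9) heavyOdds-unique) disjoint)
    where
    bEdge : ∀ {u v} → (u , v) ∈ matching → BEdge u v
    bEdge {u} uv with ∈matching⁻ uv
    ... | _ , refl = BEdge-flipFirst 9 u refl
    disjoint : ∀ {v} → ¬ (v ∈ heavyOdds × v ∈ map (flipFirst 9) heavyOdds)
    disjoint (v∈ , v∈flipped) with ∈-map⁻ (flipFirst 9) v∈flipped
    ... | u , u∈ , refl =
      heavyOdd≢other (trans (sym (∈heavyOdds⁻ v∈)) (flipFirst-heavyOdd u (∈heavyOdds⁻ u∈)))

  pathEdge-compatible : ∀ {a b} → ((a , b) ∈ₑ matching) ⊎ QEdge a b → Compatible (class a) (class b)
  pathEdge-compatible (inj₁ (inj₁ ab)) =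
    let (aHeavyOdd , bOther) = matching-classes ab in subst₂ Compatible (sym aHeavyOdd) (sym bOther) _
  pathEdge-compatible (inj₁ (inj₂ ba)) =
    let (bHeavyOdd , aOther) = matching-classes ba in subst₂ Compatible (sym aOther) (sym bHeavyOdd) _
  pathEdge-compatible {a} {b} (inj₂ ab) = QEdge⇒Compatible a b ab

  -- The partner of t in the matching is one of its path neighbours and is of class other.
  path-unsandwiched : ∀ {P} → Unique P → (∀ {u v} → (u , v) ∈ matching → Consec u v P ⊎ Consec v u P) →
                      ∀ {a t b} → Consec a t P → Consec t b P → ¬ Sandwiched (class a) (class t) (class b)
  path-unsandwiched unique covers {a} {t} {b} at tb (aHeavyEven , tHeavyOdd , bHeavyEven)
    with covers (∈matching⁺ t tHeavyOdd)
  ... | inj₁ t-t′ = heavyEven≢other (begin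
    heavyEven             ≡⟨ bHeavyEven ⟨
    class b               ≡⟨ cong class (successor-unique unique tb t-t′) ⟩
    class (flipFirst 9 t) ≡⟨ flipFirst-heavyOdd t tHeavyOdd ⟩
    other                 ∎)
    where open ≡-Reasoning
  ... | inj₂ t′-t = heavyEven≢other (begin
    heavyEven             ≡⟨ aHeavyEven ⟨
    class a               ≡⟨ cong class (predecessor-unique unique at t′-t) ⟩
    class (flipFirst 9 t) ≡⟨ flipFirst-heavyOdd t tHeavyOdd ⟩
    other                 ∎)
    where open ≡-Reasoning

  noExtension : ∀ P → ¬ ExtendsTo matching P
  noExtension P (hamiltonian , covers , edges) =
    ≤⇒≯ (subst₂ (λ s n → s + s ≤ 2 + n) (sameCount heavyEven) (sameCount heavyOdd) pathBound)
        (subst₂ (λ s n → 2 + n < s + s) (sym (count-heavyEven m)) (sym (count-heavyOdd m))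
                (heavyEven-excess (#even m) (#odd m) (#odd≤#even m) (1≤#even m)))
    where
    labels : List Class
    labels = map class P
    sameCount : ∀ c → count c labels ≡ count c (map class (vertices (9 + m)))
    sameCount c = count-↭ c (map⁺ class (hamiltonian⇒↭vertices hamiltonian))
    pathBound : count heavyEven labels + count heavyEven labels ≤ 2 + count heavyOdd labels
    pathBound = twice-heavyEven≤2+heavyOdd labels (AllConsec-map class pathEdge-compatible P edges)
                  (consec⇒AllTriples-map class P (path-unsandwiched (proj₁ hamiltonian) covers))

mainTheorem14 : ∀ (n : ℕ) → 9 ≤ n →
    Σ (List (Vertex n × Vertex n)) (λ M →
      IsMatchingB M × (∀ (P : List (Vertex n)) → ¬ ExtendsTo M P))
mainTheorem14 n 9≤n with m≤n⇒∃[o]m+o≡n 9≤n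
... | m , refl = matching m , matching-isMatchingB m , noExtension m
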